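{- Let $n > t$ be positive integers, and set either (i) $m = t^2+1$ and $d = 2t+n-1$, where $t \ge 2$; or (ii) $m = t^2+t+1$ and $d = 2t+n$, where $t \ge 1$. Define the additive surjection \[ \chi : \mathbb{Z}_{\ge 0}^3 \to \mathbb{Z}/m\mathbb{Z} \oplus \mathbb{Z}/n\mathbb{Z}, \qquad (p,q,r) \mapsto (p-tq \bmod m,\; p+q+r \bmod n). \] Then for every $N \ge d$, the $Q_2$-coloring of $Q_N$ induced by $\chi$ is $d$-polychromatic, and it uses $mn$ colors.
   Context: $Q_N$ denotes the $N$-dimensional hypercube with vertex set $\{0,1\}^N$. A $k$-dimensional face of $Q_N$ is identified with a string in $\{0,1,\ast\}^N$ with exactly $k$ symbols $\ast$, its vertices being obtained by replacing each $\ast$ by $0$ or $1$. A $Q_2$-coloring of $Q_N$ colors every $2$-dimensional face; it is $d$-polychromatic if every $d$-dimensional face of $Q_N$ contains, among its $2$-dimensional subfaces, faces of every color used. A map $\chi:\mathbb{Z}_{\ge 0}^3\to S$ induces a $Q_2$-coloring of $Q_N$ as follows: a $2$-face, i.e. a string with two $\ast$'s, splits into three (possibly empty) regions of $0/1$ symbols (before the first $\ast$, between the two, after the second); if these regions contain $p$, $q$, $r$ ones respectively, the face receives color $\chi(p,q,r)$. -}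

module Defs where

open import Data.Nat as ℕ using (ℕ; zero; suc; _+_; _*_; _<_)
open import Data.Integer as ℤ using (ℤ; +_; _-_)
open import Data.Integer.DivMod using (_%ℕ_)
open import Data.List using (List; []; _∷_)
open import Data.Vec using (Vec; toList; lookup)
open import Data.Fin using (Fin)
open import Data.Product using (_×_; _,_; Σ-syntax)
open import Data.Sum using (_⊎_)
open import Relation.Binary.PropositionalEquality using (_≡_)

-- Symbols of a face string in {0,1,*}^N
data Sym : Set where
  𝟘 𝟙 ✶ : Sym

Face : ℕ → Set
Face N = Vec Sym N

stars : List Sym → ℕ
stars []       = 0
stars (✶ ∷ w)  = suc (stars w)
stars (_ ∷ w)  = stars w

dim : ∀ {N} → Face N → ℕ
dim F = stars (toList F)

onesBefore : List Sym → ℕ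
onesBefore []      = 0
onesBefore (𝟙 ∷ w) = suc (onesBefore w)
onesBefore (𝟘 ∷ w) = onesBefore w
onesBefore (✶ ∷ w) = 0

afterStar : List Sym → List Sym
afterStar []      = []
afterStar (✶ ∷ w) = w
afterStar (_ ∷ w) = afterStar w

ones : List Sym → ℕ
ones []      = 0
ones (𝟙 ∷ w) = suc (ones w)
ones (_ ∷ w) = ones w

pqr : ∀ {N} → Face N → ℕ × ℕ × ℕ
pqr F = let w = toList F in
  onesBefore w , onesBefore (afterStar w) , ones (afterStar (afterStar w))

-- residue of an integer modulo k, as a natural number in [0,k) (convention for k = 0 irrelevant)
zmod : ℤ → ℕ → ℕ
zmod z zero    = 0
zmod z (suc k) = z %ℕ suc k

χ : (t m n : ℕ) → ℕ × ℕ × ℕ → ℕ × ℕ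
χ t m n (p , q , r) = zmod (+ p - + (t * q)) m , zmod (+ (p + q + r)) n

color : (t m n : ℕ) → ∀ {N} → Face N → ℕ × ℕ
color t m n F = χ t m n (pqr F)

_⊑_ : ∀ {N} → Face N → Face N → Set
_⊑_ {N} G F = (i : Fin N) → (lookup F i ≡ ✶) ⊎ (lookup G i ≡ lookup F i)

IsColor : ℕ → ℕ → ℕ × ℕ → Set
IsColor m n (a , b) = (a < m) × (b < n)

UsesAllColors : (t m n N : ℕ) → Set
UsesAllColors t m n N =
  ((F : Face N) → dim F ≡ 2 → IsColor m n (color t m n F)) ×
  ((c : ℕ × ℕ) → IsColor m n c → Σ[ F ∈ Face N ] (dim F ≡ 2 × color t m n F ≡ c))

Polychromatic : (t m n d N : ℕ) → Set
Polychromatic t m n d N =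
  (F : Face N) → dim F ≡ d →
  (G₀ : Face N) → dim G₀ ≡ 2 →
  Σ[ G ∈ Face N ] (dim G ≡ 2 × G ⊑ F × color t m n G ≡ color t m n G₀)

Conclusion : (t m n d : ℕ) → Set
Conclusion t m n d = (N : ℕ) → d ℕ.≤ N → Polychromatic t m n d N × UsesAllColors t m n N

module Submission where

-- Write m = tY + 1 and d = t + Y + n − 1 with Y ∈ {t, t + 1}; the argument works for every
-- Y ≥ 2. In a d-face F mark the stars s₁, s₂, s₃, s₄ in positions t, t + 1, t + Y, t + Y + 1,
-- and number the choices (s₁,s₃), (s₂,s₃), (s₁,s₄), (s₂,s₄) of the two stars of a subface G
-- as options 1–4. If G puts x, y, z ones on the other stars of its three regions, it has
-- color (a, b) iff x − t y ≡ cᵢ (mod m) and T + x + y + z ≡ b (mod n) for constants cᵢ, T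
-- depending on F, a, b only; moreover c₁ + c₄ = c₂ + c₃.
-- Under options 1 and 2 the last region has n − 1 free stars, so z settles the second
-- coordinate. Under option 1 the values x − t y are tY consecutive integers and miss only
-- the residue t; under option 2 only the residues t + a′ with 1 ≤ a′ ≤ t are missed. Then
-- c₄ ≡ c₃ + a′, and shifting a representation of c₃ under option 3 gives one of c₄ under
-- option 4 whose sum x + y differs by some δ with 0 < δ ≤ t < n. Now z ranges over n − 1
-- values only, but the two sums cannot both need the missing one.

open import Data.Nat using (ℕ)

module Congruence where

  open import Data.Nat as ℕ using (ℕ; suc; NonZero)
  import Data.Nat.Properties as ℕ
  import Data.Nat.DivMod as ℕ
  open import Data.Integer using (ℤ; +_; -[1+_]; 0ℤ; _+_; _-_; _*_; -_)
  import Data.Integer.Properties as ℤ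
  open import Data.Integer.DivMod using (_%ℕ_; _/ℕ_; n%ℕd<d; a≡a%ℕn+[a/ℕn]*n)
  open import Data.Integer.Tactic.RingSolver using (solve-∀)
  open import Data.Product using (∃-syntax; _×_; _,_; proj₂)
  open import Data.Sum using (_⊎_; inj₁; inj₂)
  open import Relation.Binary.Bundles using (Setoid)
  open import Relation.Binary.PropositionalEquality
  import Relation.Binary.Reasoning.Setoid as SetoidReasoning
  open import Relation.Nullary using (yes; no; ¬_; contradiction)
  open import Defs using (zmod)

  infix 4 _≈_[mod_]

  record _≈_[mod_] (x y : ℤ) (m : ℕ) : Set where
    constructor multiple
    field
      k : ℤ
      x≡y+km : x ≡ y + k * + m

  module _ {m : ℕ} where

    ≈-reflexive : ∀ {x y} → x ≡ y → x ≈ y [mod m ]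
    ≈-reflexive {x} refl = multiple 0ℤ (identity x (+ m))
      where
      identity : ∀ x m → x ≡ x + 0ℤ * m
      identity = solve-∀

    ≈-refl : ∀ {x} → x ≈ x [mod m ]
    ≈-refl = ≈-reflexive refl

    ≈-sym : ∀ {x y} → x ≈ y [mod m ] → y ≈ x [mod m ]
    ≈-sym {y = y} (multiple k x≡) =
      multiple (- k) (trans (identity y k (+ m)) (cong (λ w → w + - k * + m) (sym x≡)))
      where
      identity : ∀ y k m → y ≡ y + k * m + - k * m
      identity = solve-∀

    ≈-trans : ∀ {x y z} → x ≈ y [mod m ] → y ≈ z [mod m ] → x ≈ z [mod m ]
    ≈-trans {z = z} (multiple k refl) (multiple l refl) = multiple (l + k) (identity z k l (+ m))
      where
      identity : ∀ z k l m → z + l * m + k * m ≡ z + (l + k) * m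
      identity = solve-∀

    +-cong : ∀ {x x′ y y′} → x ≈ x′ [mod m ] → y ≈ y′ [mod m ] → x + y ≈ x′ + y′ [mod m ]
    +-cong {x′ = x′} {y′ = y′} (multiple k refl) (multiple l refl) = multiple (k + l) (identity x′ y′ k l (+ m))
      where
      identity : ∀ x y k l m → x + k * m + (y + l * m) ≡ x + y + (k + l) * m
      identity = solve-∀

    +-congˡ : ∀ z {y y′} → y ≈ y′ [mod m ] → z + y ≈ z + y′ [mod m ]
    +-congˡ z = +-cong (≈-refl {z})

    -‿cong : ∀ {x x′ y y′} → x ≈ x′ [mod m ] → y ≈ y′ [mod m ] → x - y ≈ x′ - y′ [mod m ]
    -‿cong {x′ = x′} {y′ = y′} (multiple k refl) (multiple l refl) = multiple (k - l) (identity x′ y′ k l (+ m))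
      where
      identity : ∀ x y k l m → x + k * m - (y + l * m) ≡ x - y + (k - l) * m
      identity = solve-∀

  +-modulus : ∀ {m} x → x + + m ≈ x [mod m ]
  +-modulus {m} x = multiple (+ 1) (identity x (+ m))
    where
    identity : ∀ x m → x + m ≡ x + + 1 * m
    identity = solve-∀

  ≈-setoid : ℕ → Setoid _ _
  ≈-setoid m = record
    { Carrier = ℤ
    ; _≈_ = λ x y → x ≈ y [mod m ]
    ; isEquivalence = record { refl = ≈-refl ; sym = ≈-sym ; trans = ≈-trans }
    }

  module ≈-Reasoning (m : ℕ) = SetoidReasoning (≈-setoid m)

  residue : ∀ {m} .{{_ : NonZero m}} x → ∃[ u ] u ℕ.< m × x ≈ + u [mod m ]
  residue {m} x = x %ℕ m , n%ℕd<d x m , multiple (x /ℕ m) (a≡a%ℕn+[a/ℕn]*n x m)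

  private
    residue-unique⁺ : ∀ {m a b j} → + a ≡ + b + + j * + m → a ℕ.< m → b ℕ.< m → a ≡ b
    residue-unique⁺ {suc m′} {a} {b} {j} a≡ a<m b<m = begin
      a                                ≡⟨ ℕ.m<n⇒m%n≡m a<m ⟨
      a ℕ.% suc m′                     ≡⟨ cong (ℕ._% suc m′) a≡b+jm ⟩
      (b ℕ.+ j ℕ.* suc m′) ℕ.% suc m′  ≡⟨ ℕ.[m+kn]%n≡m%n b j (suc m′) ⟩
      b ℕ.% suc m′                     ≡⟨ ℕ.m<n⇒m%n≡m b<m ⟩
      b                                ∎
      where
      open ≡-Reasoning
      a≡b+jm : a ≡ b ℕ.+ j ℕ.* suc m′
      a≡b+jm = ℤ.+-injective (trans a≡ (cong (λ w → + b + w) (sym (ℤ.pos-* j (suc m′)))))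

  residue-unique : ∀ {m a b} → + a ≈ + b [mod m ] → a ℕ.< m → b ℕ.< m → a ≡ b
  residue-unique {m} (multiple (+ j) a≡) a<m b<m = residue-unique⁺ {j = j} a≡ a<m b<m
  residue-unique {m} (multiple -[1+ j ] a≡) a<m b<m =
    sym (residue-unique⁺ {j = suc j} (_≈_[mod_].x≡y+km (≈-sym {m} (multiple -[1+ j ] a≡))) b<m a<m)

  zmod-≈ : ∀ {m a} x → x ≈ + a [mod suc m ] → a ℕ.< suc m → zmod x (suc m) ≡ a
  zmod-≈ {m} x x≈a a<m =
    residue-unique (≈-trans (≈-sym (proj₂ (proj₂ (residue {suc m} x)))) x≈a) (n%ℕd<d x (suc m)) a<m

  complete-sum : ∀ {n} .{{_ : NonZero n}} S b → ∃[ z ] z ℕ.< n × + (S ℕ.+ z) ≈ + b [mod n ]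
  complete-sum {n} S b with residue {n} (+ b - + S)
  ... | z , z<n , b-S≈z = z , z<n , (begin
    + S + + z          ≈⟨ +-congˡ (+ S) (≈-sym b-S≈z) ⟩
    + S + (+ b - + S)  ≡⟨ identity (+ S) (+ b) ⟩
    + b                ∎)
    where
    open ≈-Reasoning n
    identity : ∀ S b → S + (b - S) ≡ b
    identity = solve-∀

  -- If both sums needed the largest correction n − 1, they would agree modulo n.
  complete-one-of-two-sums : ∀ n′ S δ b → 0 ℕ.< δ → δ ℕ.< suc (suc n′) →
    (∃[ z ] z ℕ.≤ n′ × + (S ℕ.+ z) ≈ + b [mod suc (suc n′) ]) ⊎
    (∃[ z ] z ℕ.≤ n′ × + (S ℕ.+ δ ℕ.+ z) ≈ + b [mod suc (suc n′) ])
  complete-one-of-two-sums n′ S δ b 0<δ δ<n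
    with complete-sum {suc (suc n′)} S b | complete-sum {suc (suc n′)} (S ℕ.+ δ) b
  ... | z₁ , z₁<n , h₁ | z₂ , z₂<n , h₂ with z₁ ℕ.≤? n′ | z₂ ℕ.≤? n′
  ...   | yes z₁≤n′ | _         = inj₁ (z₁ , z₁≤n′ , h₁)
  ...   | no _      | yes z₂≤n′ = inj₂ (z₂ , z₂≤n′ , h₂)
  ...   | no z₁≰n′  | no z₂≰n′  = contradiction δ≡0 (ℕ.>⇒≢ 0<δ)
    where
    open ≈-Reasoning (suc (suc n′))
    largest : ∀ {z} → z ℕ.< suc (suc n′) → ¬ z ℕ.≤ n′ → z ≡ suc n′
    largest z<n z≰n′ = ℕ.≤-antisym (ℕ.≤-pred z<n) (ℕ.≰⇒> z≰n′)
    identity : ∀ S δ k → δ ≡ S + δ + k - (S + k)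
    identity = solve-∀
    δ≈0 : + δ ≈ 0ℤ [mod suc (suc n′) ]
    δ≈0 = begin
      + δ                                         ≡⟨ identity (+ S) (+ δ) (+ suc n′) ⟩
      + (S ℕ.+ δ ℕ.+ suc n′) - + (S ℕ.+ suc n′)   ≈⟨ -‿cong (subst (λ z → + (S ℕ.+ δ ℕ.+ z) ≈ + b [mod _ ]) (largest z₂<n z₂≰n′) h₂)
                                                            (subst (λ z → + (S ℕ.+ z) ≈ + b [mod _ ]) (largest z₁<n z₁≰n′) h₁) ⟩
      + b - + b                                   ≡⟨ ℤ.+-inverseʳ (+ b) ⟩
      0ℤ                                          ∎
    δ≡0 : δ ≡ 0
    δ≡0 = residue-unique δ≈0 δ<n (ℕ.s≤s ℕ.z≤n)

module Choice (t′ Y′ n′ : ℕ) where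

  open import Data.Nat as ℕ using (ℕ; zero; suc; z≤n; s≤s)
  import Data.Nat.Properties as ℕ
  import Data.Nat.DivMod as ℕ
  open import Data.Integer using (ℤ; +_; _+_; _-_; _*_)
  import Data.Integer.Properties as ℤ
  open import Data.Integer.Tactic.RingSolver using (solve-∀)
  open import Data.Nat.Tactic.RingSolver renaming (solve-∀ to ℕ-solve-∀)
  open import Data.Product using (Σ-syntax; ∃-syntax; _×_; _,_)
  open import Data.Sum using (_⊎_; inj₁; inj₂; swap)
  open import Relation.Binary.PropositionalEquality
  open import Relation.Binary.Definitions using (tri<; tri≈; tri>)
  open import Relation.Nullary using (yes; no; contradiction)
  open Congruence

  t Y M n : ℕ
  t = suc t′
  Y = suc (suc Y′)
  M = suc (t ℕ.* Y)
  n = suc (suc n′)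

  value : ℕ → ℕ → ℤ
  value x y = + x - + t * + y

  +M≡1+tY : + M ≡ + 1 + + t * + Y
  +M≡1+tY = cong (λ w → + 1 + w) (ℤ.pos-* t Y)

  value-zero : ∀ x → value x 0 ≡ + x
  value-zero x = identity (+ x) (+ t)
    where
    identity : ∀ x t → x - t * + 0 ≡ x
    identity = solve-∀

  value-+ : ∀ x y a → value (x ℕ.+ a) y ≡ value x y + + a
  value-+ x y a = identity (+ x) (+ y) (+ a) (+ t)
    where
    identity : ∀ x y a t → x + a - t * y ≡ x - t * y + a
    identity = solve-∀

  value-borrow : ∀ {x x₄ a} y → t ℕ.+ x₄ ≡ x ℕ.+ a → value x₄ y ≡ value x (suc y) + + a
  value-borrow {x} {x₄} {a} y t+x₄≡x+a = begin
    value x₄ y                       ≡⟨ identity₁ (+ t) (+ x₄) (+ y) ⟩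
    + (t ℕ.+ x₄) - + t * + suc y     ≡⟨ cong (λ w → + w - + t * + suc y) t+x₄≡x+a ⟩
    + (x ℕ.+ a) - + t * + suc y      ≡⟨ identity₂ (+ x) (+ a) (+ t) (+ y) ⟩
    value x (suc y) + + a            ∎
    where
    open ≡-Reasoning
    identity₁ : ∀ t x₄ y → x₄ - t * y ≡ t + x₄ - t * (+ 1 + y)
    identity₁ = solve-∀
    identity₂ : ∀ x a t y → x + a - t * (+ 1 + y) ≡ x - t * (+ 1 + y) + a
    identity₂ = solve-∀

  value-wrap : ∀ x → value (suc x) 0 ≈ value x Y [mod M ]
  value-wrap x = begin
    value (suc x) 0                  ≡⟨ identity (+ x) (+ t) (+ Y) ⟩
    value x Y + (+ 1 + + t * + Y)    ≡⟨ cong (λ w → value x Y + w) +M≡1+tY ⟨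
    value x Y + + M                  ≈⟨ +-modulus (value x Y) ⟩
    value x Y                        ∎
    where
    open ≈-Reasoning M
    identity : ∀ x t Y → + 1 + x - t * + 0 ≡ x - t * Y + (+ 1 + t * Y)
    identity = solve-∀

  -- x and y count the ones a 2-subface puts on the free stars of its first two regions;
  -- value x y is their contribution to p − t q.
  record Candidate (c : ℤ) (X B : ℕ) : Set where
    constructor candidate
    field
      x y : ℕ
      x≤X : x ℕ.≤ X
      y≤B : y ℕ.≤ B
      value≈c : value x y ≈ c [mod M ]

    sum : ℕ
    sum = x ℕ.+ y

  open Candidate using (sum)

  candidate-resp : ∀ {c c′ X B} → c ≈ c′ [mod M ] → Candidate c X B → Candidate c′ X B
  candidate-resp c≈c′ (candidate x y x≤X y≤B v≈c) = candidate x y x≤X y≤B (≈-trans v≈c c≈c′)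

  candidate-weaken : ∀ {c X X′ B} → X ℕ.≤ X′ → Candidate c X B → Candidate c X′ B
  candidate-weaken X≤X′ (candidate x y x≤X y≤B v≈c) = candidate x y (ℕ.≤-trans x≤X X≤X′) y≤B v≈c

  small-candidate : ∀ {u X B} → u ℕ.≤ X → Candidate (+ u) X B
  small-candidate {u} u≤X = candidate u 0 u≤X z≤n (≈-reflexive (value-zero u))

  ceiling-division : ∀ k → ∃[ x ] ∃[ y ] x ℕ.≤ t′ × x ℕ.+ k ≡ t ℕ.* y
  ceiling-division k = x , q , x≤t′ , ℕ.+-cancelˡ-≡ r (x ℕ.+ k) (t ℕ.* q) (begin
    r ℕ.+ (x ℕ.+ k)      ≡⟨ ℕ.+-assoc r x k ⟨
    r ℕ.+ x ℕ.+ k        ≡⟨ cong (ℕ._+ k) r+x≡t′ ⟩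
    t′ ℕ.+ k             ≡⟨ ℕ.+-comm t′ k ⟩
    k ℕ.+ t′             ≡⟨ ℕ.m≡m%n+[m/n]*n (k ℕ.+ t′) t ⟩
    r ℕ.+ q ℕ.* t        ≡⟨ cong (r ℕ.+_) (ℕ.*-comm q t) ⟩
    r ℕ.+ t ℕ.* q        ∎)
    where
    open ≡-Reasoning
    r q : ℕ
    r = (k ℕ.+ t′) ℕ.% t
    q = (k ℕ.+ t′) ℕ./ t
    r≤t′ : r ℕ.≤ t′
    r≤t′ = ℕ.≤-pred (ℕ.m%n<n (k ℕ.+ t′) t)
    x : ℕ
    x = t′ ℕ.∸ r
    r+x≡t′ : r ℕ.+ x ≡ t′
    r+x≡t′ = ℕ.m+[n∸m]≡n r≤t′
    x≤t′ : x ℕ.≤ t′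
    x≤t′ = ℕ.m∸n≤m t′ r

  quotient-bound : ∀ {x k y} B → x ℕ.≤ t′ → x ℕ.+ k ≡ t ℕ.* y → k ℕ.≤ t ℕ.* B → y ℕ.≤ B
  quotient-bound {x} {k} {y} B x≤t′ x+k≡ty k≤tB = ℕ.≤-pred (ℕ.*-cancelˡ-< t y (suc B) (begin-strict
    t ℕ.* y          ≡⟨ x+k≡ty ⟨
    x ℕ.+ k          ≤⟨ ℕ.+-mono-≤ x≤t′ k≤tB ⟩
    t′ ℕ.+ t ℕ.* B   <⟨ ℕ.n<1+n _ ⟩
    t ℕ.+ t ℕ.* B    ≡⟨ ℕ.*-suc t B ⟨
    t ℕ.* suc B      ∎))
    where open ℕ.≤-Reasoning

  complement-bound : ∀ {u k} j B → u ℕ.+ k ≡ M → t ℕ.* j ℕ.< u → j ℕ.+ B ≡ Y → k ℕ.≤ t ℕ.* B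
  complement-bound {u} {k} j B u+k≡M tj<u j+B≡Y = ℕ.+-cancelˡ-≤ (suc (t ℕ.* j)) k (t ℕ.* B) (begin
    suc (t ℕ.* j) ℕ.+ k          ≤⟨ ℕ.+-monoˡ-≤ k tj<u ⟩
    u ℕ.+ k                      ≡⟨ u+k≡M ⟩
    suc (t ℕ.* Y)                ≡⟨ cong (λ w → suc (t ℕ.* w)) j+B≡Y ⟨
    suc (t ℕ.* (j ℕ.+ B))        ≡⟨ cong suc (ℕ.*-distribˡ-+ t j B) ⟩
    suc (t ℕ.* j ℕ.+ t ℕ.* B)    ∎)
    where open ℕ.≤-Reasoning

  -- u is represented through u − M = x − t y, rounding M − u up to a multiple of t.
  large-candidate : ∀ {u} j B → u ℕ.< M → t ℕ.* j ℕ.< u → j ℕ.+ B ≡ Y → Candidate (+ u) t′ B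
  large-candidate {u} j B u<M tj<u j+B≡Y with ℕ.m≤n⇒∃[o]m+o≡n (ℕ.<⇒≤ u<M)
  ... | k , u+k≡M with ceiling-division k
  ...   | x , y , x≤t′ , x+k≡ty =
    candidate x y x≤t′ (quotient-bound B x≤t′ x+k≡ty (complement-bound j B u+k≡M tj<u j+B≡Y)) (begin
      value x y                  ≡⟨ cong (λ w → + x - w) (trans (sym (ℤ.pos-* t y)) (cong +_ (sym x+k≡ty))) ⟩
      + x - (+ x + + k)          ≡⟨ identity (+ x) (+ u) (+ k) ⟩
      + u - (+ u + + k)          ≡⟨ cong (λ w → + u - + w) u+k≡M ⟩
      + u - + M                  ≈⟨ ≈-sym (+-modulus (+ u - + M)) ⟩
      + u - + M + + M            ≡⟨ identity₂ (+ u) (+ M) ⟩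
      + u                        ∎)
    where
    open ≈-Reasoning M
    identity : ∀ x u k → x - (x + k) ≡ u - (u + k)
    identity = solve-∀
    identity₂ : ∀ u m → u - m + m ≡ u
    identity₂ = solve-∀

  any-candidate : ∀ c → Candidate c t′ Y
  any-candidate c with residue {M} c
  ... | zero  , _   , c≈u = candidate-resp (≈-sym c≈u) (small-candidate z≤n)
  ... | suc u , u<M , c≈u =
    candidate-resp (≈-sym c≈u) (large-candidate 0 Y u<M (subst (ℕ._< suc u) (sym (ℕ.*-zeroʳ t)) (s≤s z≤n)) refl)

  Solution : ℤ → ℕ → ℕ → ℕ → ℕ → ℕ → Set
  Solution c T b X B Z =
    Σ[ k ∈ Candidate c X B ] ∃[ z ] z ℕ.≤ Z × + (T ℕ.+ sum k ℕ.+ z) ≈ + b [mod n ]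

  complete : ∀ {c X B} T b → Candidate c X B → Solution c T b X B (suc n′)
  complete T b k with complete-sum {n} (T ℕ.+ sum k) b
  ... | z , z<n , h = k , z , ℕ.≤-pred z<n , h

  record Pair (c₃ c₄ : ℤ) : Set where
    constructor pair
    field
      k₃ : Candidate c₃ t′ Y
      k₄ : Candidate c₄ t (suc Y′)
      δ : ℕ
      0<δ : 0 ℕ.< δ
      δ≤t : δ ℕ.≤ t
      sums-apart : sum k₄ ≡ sum k₃ ℕ.+ δ ⊎ sum k₃ ≡ sum k₄ ℕ.+ δ

  private
    ordered-pair-solution : ∀ {c c′ X X′ B B′} T b δ → 0 ℕ.< δ → δ ℕ.< n →
      (k : Candidate c X B) (k′ : Candidate c′ X′ B′) → sum k′ ≡ sum k ℕ.+ δ →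
      Solution c T b X B n′ ⊎ Solution c′ T b X′ B′ n′
    ordered-pair-solution T b δ 0<δ δ<n k k′ s′≡s+δ
      with complete-one-of-two-sums n′ (T ℕ.+ sum k) δ b 0<δ δ<n
    ... | inj₁ (z , z≤n′ , h) = inj₁ (k , z , z≤n′ , h)
    ... | inj₂ (z , z≤n′ , h) = inj₂ (k′ , z , z≤n′ , subst (λ s → + (s ℕ.+ z) ≈ + b [mod n ]) shift h)
      where
      shift : T ℕ.+ sum k ℕ.+ δ ≡ T ℕ.+ sum k′
      shift = trans (ℕ.+-assoc T (sum k) δ) (cong (T ℕ.+_) (sym s′≡s+δ))

  pair-solution : ∀ {c₃ c₄} T b → t ℕ.< n → Pair c₃ c₄ →
                  Solution c₃ T b t′ Y n′ ⊎ Solution c₄ T b t (suc Y′) n′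
  pair-solution T b t<n (pair k₃ k₄ δ 0<δ δ≤t (inj₁ s₄≡s₃+δ)) =
    ordered-pair-solution T b δ 0<δ (ℕ.≤-<-trans δ≤t t<n) k₃ k₄ s₄≡s₃+δ
  pair-solution T b t<n (pair k₃ k₄ δ 0<δ δ≤t (inj₂ s₃≡s₄+δ)) =
    swap (ordered-pair-solution T b δ 0<δ (ℕ.≤-<-trans δ≤t t<n) k₄ k₃ s₃≡s₄+δ)

  module Shift {c₃ c₄ : ℤ} (a′ : ℕ) (0<a′ : 0 ℕ.< a′) (a′≤t : a′ ℕ.≤ t)
               (c₄≈c₃+a′ : c₄ ≈ c₃ + + a′ [mod M ]) where

    shifted : ∀ {v w} → v ≡ w + + a′ → w ≈ c₃ [mod M ] → v ≈ c₄ [mod M ]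
    shifted v≡w+a′ w≈c₃ = ≈-trans (≈-reflexive v≡w+a′) (≈-trans (+-cong w≈c₃ ≈-refl) (≈-sym c₄≈c₃+a′))

    shift-right : (k : Candidate c₃ t′ Y) → Candidate.x k ℕ.+ a′ ℕ.≤ t → Candidate.y k ℕ.≤ suc Y′ →
                  Pair c₃ c₄
    shift-right k@(candidate x y _ _ v≈c₃) x+a′≤t y≤Y-1 =
      pair k (candidate (x ℕ.+ a′) y x+a′≤t y≤Y-1 (shifted (value-+ x y a′) v≈c₃))
           a′ 0<a′ a′≤t (inj₁ (+-right-comm x a′ y))
      where
      +-right-comm : ∀ x a y → x ℕ.+ a ℕ.+ y ≡ x ℕ.+ y ℕ.+ a
      +-right-comm = ℕ-solve-∀

    shift-borrow : (k : Candidate c₃ t′ Y) → t ℕ.≤ Candidate.x k ℕ.+ a′ → 0 ℕ.< Candidate.y k → Pair c₃ c₄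
    shift-borrow k@(candidate x (suc y) x≤t′ sy≤Y v≈c₃) t≤x+a′ _
      with ℕ.m≤n⇒∃[o]m+o≡n t≤x+a′ | ℕ.m≤n⇒∃[o]m+o≡n a′≤t
    ... | x₄ , t+x₄≡x+a′ | g , a′+g≡t =
      pair k (candidate x₄ y x₄≤t (ℕ.≤-pred sy≤Y) (shifted (value-borrow {x} y t+x₄≡x+a′) v≈c₃))
           (suc g) (s≤s z≤n) 1+g≤t (inj₂ sums)
      where
      x≡g+x₄ : x ≡ g ℕ.+ x₄
      x≡g+x₄ = ℕ.+-cancelʳ-≡ a′ x (g ℕ.+ x₄) (begin
        x ℕ.+ a′                 ≡⟨ t+x₄≡x+a′ ⟨
        t ℕ.+ x₄                 ≡⟨ cong (ℕ._+ x₄) a′+g≡t ⟨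
        a′ ℕ.+ g ℕ.+ x₄          ≡⟨ rearrange a′ g x₄ ⟩
        g ℕ.+ x₄ ℕ.+ a′          ∎)
        where
        open ≡-Reasoning
        rearrange : ∀ a g x → a ℕ.+ g ℕ.+ x ≡ g ℕ.+ x ℕ.+ a
        rearrange = ℕ-solve-∀
      x₄≤t : x₄ ℕ.≤ t
      x₄≤t = ℕ.≤-trans (ℕ.m≤n+m x₄ g) (ℕ.≤-trans (ℕ.≤-reflexive (sym x≡g+x₄)) (ℕ.m≤n⇒m≤1+n x≤t′))
      1+g≤t : suc g ℕ.≤ t
      1+g≤t = subst (suc g ℕ.≤_) a′+g≡t (ℕ.+-monoˡ-≤ g 0<a′)
      sums : x ℕ.+ suc y ≡ x₄ ℕ.+ y ℕ.+ suc g
      sums = trans (cong (ℕ._+ suc y) x≡g+x₄) (rearrange g x₄ y)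
        where
        rearrange : ∀ g x y → g ℕ.+ x ℕ.+ suc y ≡ x ℕ.+ y ℕ.+ suc g
        rearrange = ℕ-solve-∀

    -- Candidates on the boundary y = 0 or y = Y are first moved to the other
    -- boundary, using value (x + 1) 0 ≡ value x Y (mod M).
    shift-pair : Candidate c₃ t′ Y → Pair c₃ c₄
    shift-pair k@(candidate x zero x≤t′ _ v≈c₃) with x ℕ.+ a′ ℕ.≤? t
    ... | yes x+a′≤t = shift-right k x+a′≤t z≤n
    shift-pair (candidate zero zero _ _ _) | no a′≰t = contradiction a′≤t a′≰t
    shift-pair (candidate (suc x) zero x≤t′ _ v≈c₃) | no x+a′≰t =
      shift-borrow (candidate x Y (ℕ.<⇒≤ x≤t′) ℕ.≤-refl (≈-trans (≈-sym (value-wrap x)) v≈c₃))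
                   (ℕ.≤-pred (ℕ.≰⇒> x+a′≰t)) (s≤s z≤n)
    shift-pair k@(candidate x (suc y) x≤t′ sy≤Y v≈c₃) with t ℕ.≤? x ℕ.+ a′
    ... | yes t≤x+a′ = shift-borrow k t≤x+a′ (s≤s z≤n)
    ... | no t≰x+a′ with suc y ℕ.≤? suc Y′
    ...   | yes y<Y = shift-right k (ℕ.<⇒≤ (ℕ.≰⇒> t≰x+a′)) y<Y
    ...   | no y≮Y = shift-right (candidate (suc x) 0 1+x≤t′ z≤n v≈c₃′) (ℕ.≰⇒> t≰x+a′) z≤n
      where
      1+x≤t′ : suc x ℕ.≤ t′
      1+x≤t′ = ℕ.≤-trans (subst (ℕ._≤ x ℕ.+ a′) (ℕ.+-comm x 1) (ℕ.+-monoʳ-≤ x 0<a′)) (ℕ.≤-pred (ℕ.≰⇒> t≰x+a′))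
      v≈c₃′ : value (suc x) 0 ≈ c₃ [mod M ]
      v≈c₃′ = ≈-trans (value-wrap x)
                (subst (λ y → value x y ≈ c₃ [mod M ]) (ℕ.≤-antisym sy≤Y (ℕ.≰⇒> y≮Y)) v≈c₃)

  offset-shift : ∀ {c₁ c₂ c₃ c₄ a′} → c₁ + c₄ ≡ c₂ + c₃ →
                 c₁ ≈ + t [mod M ] → c₂ ≈ + (t ℕ.+ a′) [mod M ] → c₄ ≈ c₃ + + a′ [mod M ]
  offset-shift {c₁} {c₂} {c₃} {c₄} {a′} c₁+c₄≡c₂+c₃ c₁≈t c₂≈t+a′ = begin
    c₄                           ≡⟨ identity₁ c₁ c₄ ⟩
    c₁ + c₄ - c₁                 ≡⟨ cong (_- c₁) c₁+c₄≡c₂+c₃ ⟩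
    c₂ + c₃ - c₁                 ≡⟨ identity₂ c₁ c₂ c₃ ⟩
    c₃ + (c₂ - c₁)               ≈⟨ +-congˡ c₃ (-‿cong c₂≈t+a′ c₁≈t) ⟩
    c₃ + (+ t + + a′ - + t)      ≡⟨ cong (λ w → c₃ + w) (identity₃ (+ t) (+ a′)) ⟩
    c₃ + + a′                    ∎
    where
    open ≈-Reasoning M
    identity₁ : ∀ c₁ c₄ → c₄ ≡ c₁ + c₄ - c₁
    identity₁ = solve-∀
    identity₂ : ∀ c₁ c₂ c₃ → c₂ + c₃ - c₁ ≡ c₃ + (c₂ - c₁)
    identity₂ = solve-∀
    identity₃ : ∀ t a → t + a - t ≡ a
    identity₃ = solve-∀

  choose-given-c₁≈t : ∀ {c₁ c₂ c₃ c₄} T b → t ℕ.< n → c₁ + c₄ ≡ c₂ + c₃ → c₁ ≈ + t [mod M ] →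
    Solution c₂ T b t Y′ (suc n′) ⊎ Solution c₃ T b t′ Y n′ ⊎ Solution c₄ T b t (suc Y′) n′
  choose-given-c₁≈t {c₂ = c₂} {c₃} T b t<n rel c₁≈t with residue {M} c₂
  ... | u₂ , u₂<M , c₂≈u₂ with u₂ ℕ.≤? t
  ...   | yes u₂≤t = inj₁ (complete T b (candidate-resp (≈-sym c₂≈u₂) (small-candidate u₂≤t)))
  ...   | no u₂≰t with t ℕ.+ t ℕ.<? u₂
  ...     | yes 2t<u₂ = inj₁ (complete T b (candidate-resp (≈-sym c₂≈u₂)
                          (candidate-weaken (ℕ.n≤1+n t′) (large-candidate 2 Y′ u₂<M (subst (ℕ._< u₂) (twice t) 2t<u₂) refl))))
    where
    twice : ∀ t → t ℕ.+ t ≡ t ℕ.* 2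
    twice = ℕ-solve-∀
  ...     | no 2t≮u₂ with ℕ.m≤n⇒∃[o]m+o≡n (ℕ.≰⇒> u₂≰t)
  ...       | o , 1+t+o≡u₂ = inj₂ (pair-solution T b t<n
                (Shift.shift-pair (suc o) (s≤s z≤n) a′≤t (offset-shift rel c₁≈t c₂≈t+a′) (any-candidate c₃)))
    where
    t+a′≡u₂ : t ℕ.+ suc o ≡ u₂
    t+a′≡u₂ = trans (ℕ.+-suc t o) 1+t+o≡u₂
    a′≤t : suc o ℕ.≤ t
    a′≤t = ℕ.+-cancelˡ-≤ t (suc o) t (subst (ℕ._≤ t ℕ.+ t) (sym t+a′≡u₂) (ℕ.≮⇒≥ 2t≮u₂))
    c₂≈t+a′ : c₂ ≈ + (t ℕ.+ suc o) [mod M ]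
    c₂≈t+a′ = subst (λ u → c₂ ≈ + u [mod M ]) (sym t+a′≡u₂) c₂≈u₂

  choose : ∀ {c₁ c₂ c₃ c₄} T b → t ℕ.< n → c₁ + c₄ ≡ c₂ + c₃ →
    Solution c₁ T b t′ (suc Y′) (suc n′) ⊎ Solution c₂ T b t Y′ (suc n′) ⊎
    Solution c₃ T b t′ Y n′ ⊎ Solution c₄ T b t (suc Y′) n′
  choose {c₁} T b t<n rel with residue {M} c₁
  ... | u₁ , u₁<M , c₁≈u₁ with ℕ.<-cmp u₁ t
  ...   | tri< u₁<t _ _ = inj₁ (complete T b (candidate-resp (≈-sym c₁≈u₁) (small-candidate (ℕ.≤-pred u₁<t))))
  ...   | tri> _ _ t<u₁ = inj₁ (complete T b (candidate-resp (≈-sym c₁≈u₁)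
                            (large-candidate 1 (suc Y′) u₁<M (subst (ℕ._< u₁) (sym (ℕ.*-identityʳ t)) t<u₁) refl)))
  ...   | tri≈ _ refl _ = inj₂ (choose-given-c₁≈t T b t<n rel c₁≈u₁)

module Faces where

  open import Defs
  open import Data.Nat using (ℕ; zero; suc; _+_; _≤_; z≤n; s≤s)
  import Data.Nat.Properties as ℕ
  open import Data.List using (List; []; _∷_; _++_; length)
  import Data.List.Properties as List
  open import Data.Vec using (toList) renaming ([] to []ᵥ; _∷_ to _∷ᵥ_)
  open import Data.Fin using () renaming (zero to fzero; suc to fsuc)
  open import Data.Product using (Σ-syntax; ∃-syntax; _×_; _,_)
  open import Data.Sum using (inj₁; inj₂)
  open import Relation.Binary.PropositionalEquality

  infixr 5 _⋆_

  _⋆_ : List Sym → List Sym → List Sym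
  u ⋆ v = u ++ ✶ ∷ v

  ⋆-assoc : ∀ u v w → (u ⋆ v) ⋆ w ≡ u ⋆ v ⋆ w
  ⋆-assoc u v w = List.++-assoc u (✶ ∷ v) (✶ ∷ w)

  ones-⋆ : ∀ u v → ones (u ⋆ v) ≡ ones u + ones v
  ones-⋆ []      v = refl
  ones-⋆ (𝟘 ∷ u) v = ones-⋆ u v
  ones-⋆ (𝟙 ∷ u) v = cong suc (ones-⋆ u v)
  ones-⋆ (✶ ∷ u) v = ones-⋆ u v

  stars-⋆ : ∀ u v → stars (u ⋆ v) ≡ stars u + suc (stars v)
  stars-⋆ []      v = refl
  stars-⋆ (𝟘 ∷ u) v = stars-⋆ u v
  stars-⋆ (𝟙 ∷ u) v = stars-⋆ u v
  stars-⋆ (✶ ∷ u) v = cong suc (stars-⋆ u v)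

  onesBefore-⋆ : ∀ u v → stars u ≡ 0 → onesBefore (u ⋆ v) ≡ ones u
  onesBefore-⋆ []      v _ = refl
  onesBefore-⋆ (𝟘 ∷ u) v h = onesBefore-⋆ u v h
  onesBefore-⋆ (𝟙 ∷ u) v h = cong suc (onesBefore-⋆ u v h)

  afterStar-⋆ : ∀ u v → stars u ≡ 0 → afterStar (u ⋆ v) ≡ v
  afterStar-⋆ []      v _ = refl
  afterStar-⋆ (𝟘 ∷ u) v h = afterStar-⋆ u v h
  afterStar-⋆ (𝟙 ∷ u) v h = afterStar-⋆ u v h

  split-at-star : ∀ w k l → stars w ≡ k + suc l →
                  ∃[ u ] ∃[ v ] w ≡ u ⋆ v × stars u ≡ k × stars v ≡ l
  split-at-star []      k       l h with () ← trans h (ℕ.+-suc k l)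
  split-at-star (✶ ∷ w) zero    l h = [] , w , refl , refl , ℕ.suc-injective h
  split-at-star (✶ ∷ w) (suc k) l h with split-at-star w k l (ℕ.suc-injective h)
  ... | u , v , refl , su , sv = ✶ ∷ u , v , refl , cong suc su , sv
  split-at-star (𝟘 ∷ w) k       l h with split-at-star w k l h
  ... | u , v , refl , su , sv = 𝟘 ∷ u , v , refl , su , sv
  split-at-star (𝟙 ∷ w) k       l h with split-at-star w k l h
  ... | u , v , refl , su , sv = 𝟙 ∷ u , v , refl , su , sv

  pqr-⋆ : ∀ {N} (G : Face N) {u v w} → toList G ≡ u ⋆ v ⋆ w → stars u ≡ 0 → stars v ≡ 0 →
          pqr G ≡ (ones u , ones v , ones w)
  pqr-⋆ G {u} {v} {w} G≡ su sv rewrite G≡ | afterStar-⋆ u (v ⋆ w) su | afterStar-⋆ v w sv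
    | onesBefore-⋆ u (v ⋆ w) su | onesBefore-⋆ v w sv = refl

  fillˡ : List Sym → List Sym → List Sym
  fillˡ []      _       = []
  fillˡ (𝟘 ∷ w) p       = 𝟘 ∷ fillˡ w p
  fillˡ (𝟙 ∷ w) p       = 𝟙 ∷ fillˡ w p
  fillˡ (✶ ∷ w) []      = ✶ ∷ w
  fillˡ (✶ ∷ w) (s ∷ p) = s ∷ fillˡ w p

  fill : ∀ {N} → Face N → List Sym → Face N
  fill []ᵥ        _       = []ᵥ
  fill (𝟘 ∷ᵥ F)  p       = 𝟘 ∷ᵥ fill F p
  fill (𝟙 ∷ᵥ F)  p       = 𝟙 ∷ᵥ fill F p
  fill (✶ ∷ᵥ F)  []      = ✶ ∷ᵥ F
  fill (✶ ∷ᵥ F)  (s ∷ p) = s ∷ᵥ fill F p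

  toList-fill : ∀ {N} (F : Face N) p → toList (fill F p) ≡ fillˡ (toList F) p
  toList-fill []ᵥ       _       = refl
  toList-fill (𝟘 ∷ᵥ F) p       = cong (𝟘 ∷_) (toList-fill F p)
  toList-fill (𝟙 ∷ᵥ F) p       = cong (𝟙 ∷_) (toList-fill F p)
  toList-fill (✶ ∷ᵥ F) []      = refl
  toList-fill (✶ ∷ᵥ F) (s ∷ p) = cong (s ∷_) (toList-fill F p)

  fill-⊑ : ∀ {N} (F : Face N) p → fill F p ⊑ F
  fill-⊑ (𝟘 ∷ᵥ F) p       fzero    = inj₂ refl
  fill-⊑ (𝟘 ∷ᵥ F) p       (fsuc i) = fill-⊑ F p i
  fill-⊑ (𝟙 ∷ᵥ F) p       fzero    = inj₂ refl
  fill-⊑ (𝟙 ∷ᵥ F) p       (fsuc i) = fill-⊑ F p i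
  fill-⊑ (✶ ∷ᵥ F) []      i        = inj₂ refl
  fill-⊑ (✶ ∷ᵥ F) (s ∷ p) fzero    = inj₁ refl
  fill-⊑ (✶ ∷ᵥ F) (s ∷ p) (fsuc i) = fill-⊑ F p i

  fillˡ-⋆ : ∀ u v p q → stars u ≡ length p → fillˡ (u ⋆ v) (p ⋆ q) ≡ fillˡ u p ⋆ fillˡ v q
  fillˡ-⋆ []      v []      q _ = refl
  fillˡ-⋆ (𝟘 ∷ u) v p       q h = cong (𝟘 ∷_) (fillˡ-⋆ u v p q h)
  fillˡ-⋆ (𝟙 ∷ u) v p       q h = cong (𝟙 ∷_) (fillˡ-⋆ u v p q h)
  fillˡ-⋆ (✶ ∷ u) v (s ∷ p) q h = cong (s ∷_) (fillˡ-⋆ u v p q (ℕ.suc-injective h))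

  stars-fillˡ : ∀ w p → stars w ≡ length p → stars (fillˡ w p) ≡ stars p
  stars-fillˡ []      []      _ = refl
  stars-fillˡ (𝟘 ∷ w) p       h = stars-fillˡ w p h
  stars-fillˡ (𝟙 ∷ w) p       h = stars-fillˡ w p h
  stars-fillˡ (✶ ∷ w) (𝟘 ∷ p) h = stars-fillˡ w p (ℕ.suc-injective h)
  stars-fillˡ (✶ ∷ w) (𝟙 ∷ p) h = stars-fillˡ w p (ℕ.suc-injective h)
  stars-fillˡ (✶ ∷ w) (✶ ∷ p) h = cong suc (stars-fillˡ w p (ℕ.suc-injective h))

  ones-fillˡ : ∀ w p → stars w ≡ length p → ones (fillˡ w p) ≡ ones w + ones p
  ones-fillˡ []      []      _ = refl
  ones-fillˡ (𝟘 ∷ w) p       h = ones-fillˡ w p h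
  ones-fillˡ (𝟙 ∷ w) p       h = cong suc (ones-fillˡ w p h)
  ones-fillˡ (✶ ∷ w) (𝟘 ∷ p) h = ones-fillˡ w p (ℕ.suc-injective h)
  ones-fillˡ (✶ ∷ w) (𝟙 ∷ p) h = trans (cong suc (ones-fillˡ w p (ℕ.suc-injective h))) (sym (ℕ.+-suc (ones w) (ones p)))
  ones-fillˡ (✶ ∷ w) (✶ ∷ p) h = ones-fillˡ w p (ℕ.suc-injective h)

  bits : ℕ → ℕ → List Sym
  bits zero    _       = []
  bits (suc k) zero    = 𝟘 ∷ bits k zero
  bits (suc k) (suc x) = 𝟙 ∷ bits k x

  length-bits : ∀ k x → length (bits k x) ≡ k
  length-bits zero    _       = refl
  length-bits (suc k) zero    = cong suc (length-bits k zero)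
  length-bits (suc k) (suc x) = cong suc (length-bits k x)

  stars-bits : ∀ k x → stars (bits k x) ≡ 0
  stars-bits zero    _       = refl
  stars-bits (suc k) zero    = stars-bits k zero
  stars-bits (suc k) (suc x) = stars-bits k x

  ones-bits : ∀ {k x} → x ≤ k → ones (bits k x) ≡ x
  ones-bits {zero}  z≤n     = refl
  ones-bits {suc k} z≤n     = ones-bits {k} z≤n
  ones-bits         (s≤s h) = cong suc (ones-bits h)

  subface-with-ones : ∀ {N} (F : Face N) {w₁ w₂ w₃} → toList F ≡ w₁ ⋆ w₂ ⋆ w₃ →
    ∀ {x y z} → x ≤ stars w₁ → y ≤ stars w₂ → z ≤ stars w₃ →
    Σ[ G ∈ Face N ] dim G ≡ 2 × G ⊑ F × pqr G ≡ (ones w₁ + x , ones w₂ + y , ones w₃ + z)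
  subface-with-ones F {w₁} {w₂} {w₃} F≡ {x} {y} {z} x≤ y≤ z≤ =
    fill F (p₁ ⋆ p₂ ⋆ p₃) , dim-G , fill-⊑ F (p₁ ⋆ p₂ ⋆ p₃) , pqr-G
    where
    p₁ = bits (stars w₁) x
    p₂ = bits (stars w₂) y
    p₃ = bits (stars w₃) z
    G≡ : toList (fill F (p₁ ⋆ p₂ ⋆ p₃)) ≡ fillˡ w₁ p₁ ⋆ fillˡ w₂ p₂ ⋆ fillˡ w₃ p₃
    G≡ = begin
      toList (fill F (p₁ ⋆ p₂ ⋆ p₃))            ≡⟨ toList-fill F _ ⟩
      fillˡ (toList F) (p₁ ⋆ p₂ ⋆ p₃)           ≡⟨ cong (λ w → fillˡ w (p₁ ⋆ p₂ ⋆ p₃)) F≡ ⟩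
      fillˡ (w₁ ⋆ w₂ ⋆ w₃) (p₁ ⋆ p₂ ⋆ p₃)      ≡⟨ fillˡ-⋆ w₁ _ p₁ _ (sym (length-bits _ x)) ⟩
      fillˡ w₁ p₁ ⋆ fillˡ (w₂ ⋆ w₃) (p₂ ⋆ p₃)  ≡⟨ cong (fillˡ w₁ p₁ ⋆_) (fillˡ-⋆ w₂ w₃ p₂ p₃ (sym (length-bits _ y))) ⟩
      fillˡ w₁ p₁ ⋆ fillˡ w₂ p₂ ⋆ fillˡ w₃ p₃  ∎
      where open ≡-Reasoning
    no-stars : ∀ w k → stars (fillˡ w (bits (stars w) k)) ≡ 0
    no-stars w k = trans (stars-fillˡ w _ (sym (length-bits _ k))) (stars-bits (stars w) k)
    ones-filled : ∀ w {k} → k ≤ stars w → ones (fillˡ w (bits (stars w) k)) ≡ ones w + k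
    ones-filled w k≤ = trans (ones-fillˡ w _ (sym (length-bits _ _))) (cong (ones w +_) (ones-bits k≤))
    dim-G : dim (fill F (p₁ ⋆ p₂ ⋆ p₃)) ≡ 2
    dim-G = begin
      stars (toList (fill F (p₁ ⋆ p₂ ⋆ p₃)))      ≡⟨ cong stars G≡ ⟩
      stars (fillˡ w₁ p₁ ⋆ fillˡ w₂ p₂ ⋆ fillˡ w₃ p₃)
        ≡⟨ stars-⋆ (fillˡ w₁ p₁) _ ⟩
      stars (fillˡ w₁ p₁) + suc (stars (fillˡ w₂ p₂ ⋆ fillˡ w₃ p₃))
        ≡⟨ cong₂ (λ a b → a + suc b) (no-stars w₁ x) (stars-⋆ (fillˡ w₂ p₂) _) ⟩
      suc (stars (fillˡ w₂ p₂) + suc (stars (fillˡ w₃ p₃)))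
        ≡⟨ cong₂ (λ a b → suc (a + suc b)) (no-stars w₂ y) (no-stars w₃ z) ⟩
      2 ∎
      where open ≡-Reasoning
    pqr-G : pqr (fill F (p₁ ⋆ p₂ ⋆ p₃)) ≡ (ones w₁ + x , ones w₂ + y , ones w₃ + z)
    pqr-G = trans (pqr-⋆ (fill F _) G≡ (no-stars w₁ x) (no-stars w₂ y))
                  (cong₂ _,_ (ones-filled w₁ x≤) (cong₂ _,_ (ones-filled w₂ y≤) (ones-filled w₃ z≤)))

module Realisation (t′ Y′ n′ : ℕ) where

  open import Defs
  open import Data.Nat as ℕ using (suc)
  import Data.Nat.Properties as ℕ
  open import Data.Integer using (ℤ; +_; _+_; _-_; _*_)
  import Data.Integer.Properties as ℤ
  open import Data.Integer.Tactic.RingSolver using (solve-∀)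
  open import Data.Nat.Tactic.RingSolver renaming (solve-∀ to ℕ-solve-∀)
  open import Data.List using (List)
  open import Data.Vec using (toList)
  open import Data.Product using (Σ-syntax; _×_; _,_)
  open import Data.Sum using (inj₁; inj₂)
  open import Relation.Binary.PropositionalEquality
  open Congruence
  open Faces
  open Choice t′ Y′ n′

  record Regions {N} (F : Face N) (P Q R X B Z : ℕ) : Set where
    constructor regions
    field
      w₁ w₂ w₃ : List Sym
      F≡ : toList F ≡ w₁ ⋆ w₂ ⋆ w₃
      ones₁ : ones w₁ ≡ P
      ones₂ : ones w₂ ≡ Q
      ones₃ : ones w₃ ≡ R
      stars₁ : stars w₁ ≡ X
      stars₂ : stars w₂ ≡ B
      stars₃ : stars w₃ ≡ Z

  offset : ℕ → ℕ → ℕ → ℤ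
  offset a P Q = + a - (+ P - + t * + Q)

  realise : ∀ {N} {F : Face N} {P Q R X B Z a b} → a ℕ.< M → b ℕ.< n → Regions F P Q R X B Z →
            Solution (offset a P Q) (ones (toList F)) b X B Z →
            Σ[ G ∈ Face N ] dim G ≡ 2 × G ⊑ F × color t M n G ≡ (a , b)
  realise {F = F} {P} {Q} {R} {a = a} {b} a<M b<n
          (regions w₁ w₂ w₃ F≡ refl refl refl refl refl refl)
          (candidate x y x≤X y≤B v≈c , z , z≤Z , sum≈b)
    with subface-with-ones F F≡ x≤X y≤B z≤Z
  ... | G , dim-G , G⊑F , pqr-G = G , dim-G , G⊑F , color≡
    where
    first : + (P ℕ.+ x) - + (t ℕ.* (Q ℕ.+ y)) ≈ + a [mod M ]
    first = begin
      + (P ℕ.+ x) - + (t ℕ.* (Q ℕ.+ y))     ≡⟨ cong (λ w → + (P ℕ.+ x) - w) (ℤ.pos-* t (Q ℕ.+ y)) ⟩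
      + P + + x - + t * (+ Q + + y)         ≡⟨ identity₁ (+ P) (+ Q) (+ x) (+ y) (+ t) ⟩
      (+ P - + t * + Q) + value x y         ≈⟨ +-congˡ (+ P - + t * + Q) v≈c ⟩
      (+ P - + t * + Q) + offset a P Q      ≡⟨ identity₂ (+ P) (+ Q) (+ a) (+ t) ⟩
      + a                                   ∎
      where
      open ≈-Reasoning M
      identity₁ : ∀ P Q x y t → P + x - t * (Q + y) ≡ P - t * Q + (x - t * y)
      identity₁ = solve-∀
      identity₂ : ∀ P Q a t → P - t * Q + (a - (P - t * Q)) ≡ a
      identity₂ = solve-∀
    second : + (P ℕ.+ x ℕ.+ (Q ℕ.+ y) ℕ.+ (R ℕ.+ z)) ≈ + b [mod n ]
    second = subst (λ s → + s ≈ + b [mod n ]) (trans (cong (λ T → T ℕ.+ (x ℕ.+ y) ℕ.+ z) total≡) (identity P Q R x y z)) sum≈b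
      where
      total≡ : ones (toList F) ≡ P ℕ.+ (Q ℕ.+ R)
      total≡ = trans (cong ones F≡) (trans (ones-⋆ w₁ _) (cong (P ℕ.+_) (ones-⋆ w₂ w₃)))
      identity : ∀ P Q R x y z → P ℕ.+ (Q ℕ.+ R) ℕ.+ (x ℕ.+ y) ℕ.+ z ≡ P ℕ.+ x ℕ.+ (Q ℕ.+ y) ℕ.+ (R ℕ.+ z)
      identity = ℕ-solve-∀
    color≡ : color t M n G ≡ (a , b)
    color≡ = trans (cong (χ t M n) pqr-G) (cong₂ _,_ (zmod-≈ _ first a<M) (zmod-≈ _ second b<n))

  -- The four separating stars are s₁, …, s₄.
  record Blocks {N} (F : Face N) : Set where
    constructor blocks
    field
      A B D E R : List Sym
      F≡ : toList F ≡ A ⋆ B ⋆ D ⋆ E ⋆ R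
      stars-A : stars A ≡ t′
      stars-B : stars B ≡ 0
      stars-D : stars D ≡ Y′
      stars-E : stars E ≡ 0
      stars-R : stars R ≡ n′

  blocks-of : ∀ {N} (F : Face N) → dim F ≡ t′ ℕ.+ Y ℕ.+ n → Blocks F
  blocks-of F dim-F with split-at-star (toList F) t′ _ (trans dim-F (rearrange t′ Y′ n′))
    where
    rearrange : ∀ t′ Y′ n′ → t′ ℕ.+ (2 ℕ.+ Y′) ℕ.+ (2 ℕ.+ n′) ≡ t′ ℕ.+ (2 ℕ.+ (Y′ ℕ.+ (2 ℕ.+ n′)))
    rearrange = ℕ-solve-∀
  ... | A , w , F≡A⋆w , sA , sw with split-at-star w 0 _ sw
  ... | B , w′ , refl , sB , sw′ with split-at-star w′ Y′ _ sw′
  ... | D , w″ , refl , sD , sw″ with split-at-star w″ 0 n′ sw″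
  ... | E , R , refl , sE , sR = blocks A B D E R F≡A⋆w sA sB sD sE sR

  private
    stars-⋆≡ : ∀ u v {k l} → stars u ≡ k → stars v ≡ l → stars (u ⋆ v) ≡ k ℕ.+ suc l
    stars-⋆≡ u v refl refl = stars-⋆ u v

  module _ {N} {F : Face N} (bl : Blocks F) where
    open Blocks bl

    regions₁₃ : Regions F (ones A) (ones B ℕ.+ ones D) (ones E ℕ.+ ones R) t′ (suc Y′) (suc n′)
    regions₁₃ = regions A (B ⋆ D) (E ⋆ R) (trans F≡ (cong (A ⋆_) (sym (⋆-assoc B D (E ⋆ R)))))
      refl (ones-⋆ B D) (ones-⋆ E R) stars-A (stars-⋆≡ B D stars-B stars-D) (stars-⋆≡ E R stars-E stars-R)

    regions₂₃ : Regions F (ones A ℕ.+ ones B) (ones D) (ones E ℕ.+ ones R) t Y′ (suc n′)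
    regions₂₃ = regions (A ⋆ B) D (E ⋆ R) (trans F≡ (sym (⋆-assoc A B (D ⋆ E ⋆ R))))
      (ones-⋆ A B) refl (ones-⋆ E R) (trans (stars-⋆≡ A B stars-A stars-B) (ℕ.+-comm t′ 1)) stars-D (stars-⋆≡ E R stars-E stars-R)

    regions₁₄ : Regions F (ones A) (ones B ℕ.+ (ones D ℕ.+ ones E)) (ones R) t′ Y n′
    regions₁₄ = regions A (B ⋆ D ⋆ E) R
      (trans F≡ (cong (A ⋆_) (sym (trans (⋆-assoc B (D ⋆ E) R) (cong (B ⋆_) (⋆-assoc D E R))))))
      refl (trans (ones-⋆ B (D ⋆ E)) (cong (ones B ℕ.+_) (ones-⋆ D E))) refl stars-A
      (stars-⋆≡ B (D ⋆ E) stars-B (trans (stars-⋆≡ D E stars-D stars-E) (ℕ.+-comm Y′ 1))) stars-R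

    regions₂₄ : Regions F (ones A ℕ.+ ones B) (ones D ℕ.+ ones E) (ones R) t (suc Y′) n′
    regions₂₄ = regions (A ⋆ B) (D ⋆ E) R
      (trans F≡ (trans (cong (λ w → A ⋆ B ⋆ w) (sym (⋆-assoc D E R))) (sym (⋆-assoc A B _))))
      (ones-⋆ A B) (ones-⋆ D E) refl (trans (stars-⋆≡ A B stars-A stars-B) (ℕ.+-comm t′ 1))
      (trans (stars-⋆≡ D E stars-D stars-E) (ℕ.+-comm Y′ 1)) stars-R

    -- Moving the first star of G across B changes p − t q by (t + 1)·ones B, whichever its second star.
    offsets-related : ∀ a → offset a (ones A) (ones B ℕ.+ ones D) + offset a (ones A ℕ.+ ones B) (ones D ℕ.+ ones E)
                          ≡ offset a (ones A ℕ.+ ones B) (ones D) + offset a (ones A) (ones B ℕ.+ (ones D ℕ.+ ones E))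
    offsets-related a = identity (+ a) (+ t) (+ ones A) (+ ones B) (+ ones D) (+ ones E)
      where
      identity : ∀ a t A B D E →
        a - (A - t * (B + D)) + (a - (A + B - t * (D + E))) ≡ a - (A + B - t * D) + (a - (A - t * (B + (D + E))))
      identity = solve-∀

    every-color-in-blocks : t ℕ.< n → ∀ {a b} → a ℕ.< M → b ℕ.< n →
                            Σ[ G ∈ Face N ] dim G ≡ 2 × G ⊑ F × color t M n G ≡ (a , b)
    every-color-in-blocks t<n {a} {b} a<M b<n with choose (ones (toList F)) b t<n (offsets-related a)
    ... | inj₁ s               = realise a<M b<n regions₁₃ s
    ... | inj₂ (inj₁ s)        = realise a<M b<n regions₂₃ s
    ... | inj₂ (inj₂ (inj₁ s)) = realise a<M b<n regions₁₄ s
    ... | inj₂ (inj₂ (inj₂ s)) = realise a<M b<n regions₂₄ s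

open import Defs
open import Data.Nat using (ℕ; _+_; _*_; _∸_; _≤_; _<_)
open import Data.Product using (_×_)
open import Data.Nat using (zero; suc; z≤n; s≤s)
open import Data.Nat.Tactic.RingSolver using (solve-∀)
open import Data.Integer using (+_; _-_)
open import Data.Integer.DivMod using (n%ℕd<d)
open import Data.Product using (Σ-syntax; _,_; proj₁; proj₂)
open import Data.Nat.Properties using (+-comm)
open import Data.Vec using (replicate) renaming (_∷_ to _∷ᵥ_)
open import Relation.Binary.PropositionalEquality using (_≡_; refl; cong; subst; subst₂)

EveryColorInEveryFace : (t m n d : ℕ) → Set
EveryColorInEveryFace t m n d =
  ∀ {N} (F : Face N) → dim F ≡ d → ∀ {a b} → a < m → b < n →
  Σ[ G ∈ Face N ] (dim G ≡ 2 × G ⊑ F × color t m n G ≡ (a , b))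

face-of-dim : ∀ {N d} → d ≤ N → Σ[ F ∈ Face N ] dim F ≡ d
face-of-dim {N} z≤n = replicate N 𝟘 , no-stars N
  where
  no-stars : ∀ N → dim (replicate N 𝟘) ≡ 0
  no-stars zero    = refl
  no-stars (suc N) = no-stars N
face-of-dim (s≤s d≤N) with face-of-dim d≤N
... | F , dim-F = ✶ ∷ᵥ F , cong suc dim-F

χ-in-range : ∀ t m n pqr → IsColor (suc m) (suc n) (χ t (suc m) (suc n) pqr)
χ-in-range t m n (p , q , r) = n%ℕd<d (+ p - + (t * q)) (suc m) , n%ℕd<d (+ (p + q + r)) (suc n)

color-in-range : ∀ t m n {N} (G : Face N) → IsColor (suc m) (suc n) (color t (suc m) (suc n) G)
color-in-range t m n G = χ-in-range t m n (pqr G)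

every-color⇒conclusion : ∀ {t m n d} → EveryColorInEveryFace t (suc m) (suc n) d → Conclusion t (suc m) (suc n) d
every-color⇒conclusion {t} {m} {n} every-color N d≤N = d-polychromatic , (λ G _ → color-in-range t m n G) , surjective
  where
  d-polychromatic : Polychromatic t (suc m) (suc n) _ N
  d-polychromatic F dim-F G₀ _ = every-color F dim-F (proj₁ (color-in-range t m n G₀)) (proj₂ (color-in-range t m n G₀))
  surjective : (c : ℕ × ℕ) → IsColor (suc m) (suc n) c → Σ[ G ∈ Face N ] (dim G ≡ 2 × color t (suc m) (suc n) G ≡ c)
  surjective (a , b) (a<m , b<n) with face-of-dim d≤N
  ... | F , dim-F with every-color F dim-F a<m b<n
  ...   | G , dim-G , _ , color≡ = G , dim-G , color≡

polychromatic-coloring : ∀ t Y n → 1 ≤ t → 2 ≤ Y → t < n → Conclusion t (t * Y + 1) n (t + Y + n ∸ 1)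
polychromatic-coloring (suc t′) (suc (suc Y′)) (suc (suc n′)) _ _ t<n =
  subst (λ m → Conclusion (suc t′) m (suc (suc n′)) (t′ + suc (suc Y′) + suc (suc n′))) (+-comm 1 _)
    (every-color⇒conclusion {suc t′} λ F dim-F → every-color-in-blocks (blocks-of F dim-F) t<n)
  where open Realisation t′ Y′ n′
polychromatic-coloring zero    _                _          () _        _
polychromatic-coloring (suc _) (suc zero)       _          _  (s≤s ()) _
polychromatic-coloring (suc _) (suc (suc _))    (suc zero) _  _        (s≤s ())

theorem4 : (t n : ℕ) → 1 ≤ t → t < n →
    (2 ≤ t → Conclusion t (t * t + 1) n (2 * t + n ∸ 1)) ×
    Conclusion t (t * t + t + 1) n (2 * t + n)
theorem4 t n 1≤t t<n =
  (λ 2≤t → subst (Conclusion t (t * t + 1) n) (cong (_∸ 1) (double t n))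
             (polychromatic-coloring t t n 1≤t 2≤t t<n)) ,
  subst₂ (λ m d → Conclusion t m n d) (square+t t) (cong (_∸ 1) (double+1 t n))
    (polychromatic-coloring t (suc t) n 1≤t (s≤s 1≤t) t<n)
  where
  double : ∀ t n → t + t + n ≡ 2 * t + n
  double = solve-∀
  double+1 : ∀ t n → t + suc t + n ≡ suc (2 * t + n)
  double+1 = solve-∀
  square+t : ∀ t → t * suc t + 1 ≡ t * t + t + 1
  square+t = solve-∀
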